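{- A digraph $R\in\mathfrak{T}_a\cap\mathfrak{D}_r$ belongs to $\mathfrak{R}$ if and only if $$\sum_{i=1}^{\ell(P)}\iota(P_{i-1},P_i)_R\le h_R+\ell(P)$$ for every path $P=P_0,\dots,P_{\ell(P)}$ in $R$. In particular, every flat poset (poset of height at most $1$) belongs to $\mathfrak{R}$.
   Context: A digraph $G=(V(G),A(G))$ has finite nonempty vertex set and arc set $A(G)\subseteq V(G)\times V(G)$; $vw$ denotes $(v,w)$; $G^*$ is $G$ with loops removed. $\mathfrak{D}_r$: reflexive digraphs; $\mathfrak{T}_a$: digraphs $G$ with $G^*$ acyclic. $\mathcal{H}(G,H)$: homomorphisms; $\mathcal{S}(G,H)=\mathcal{H}(G,H)\cap\mathcal{H}(G^*,H^*)$: strict homomorphisms. Subgraph $L\subseteq G$: $V(L)\subseteq V(G)$, $A(L)\subseteq A(G)$; $\xi|_L$ restriction to $V(L)$. A path is a sequence $P_0,\dots,P_{\ell(P)}$ of distinct vertices with $P_{i-1}P_i\in A(G)$; $\ell(P)$ is its length; in $G\in\mathfrak{T}_a$ paths are determined by their vertex sets. $h_G$ (height) is the largest path length; $\mathcal{P}^h_G$ the set of paths of length $h_G$. $P_\times$: digraph with vertex set $\{P_0,\dots,P_{\ell(P)}\}$ and arcs $P_{i-1}P_i$; $\mathcal{L}(G)=\{P_\times:P\in\mathcal{P}^h_G\}$. $[v,w]_H=\{u:vu,uw\in A(H)\}$, $\iota(v,w)_H=\#[v,w]_H$; for $\xi\in\mathcal{H}(L,H)$, $\mu_\xi(L)=\sum_{vw\in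 A(L^*)}\iota(\xi(v),\xi(w))_H$; $\mathcal{M}(L,H)$ is the set of $\xi\in\mathcal{H}(L,H)$ maximizing $\mu_\xi(L)$; for a set $\mathcal{L}$ of subgraphs of $G$, $\mathcal{M}^{\mathcal{L}}(G,H)=\{\xi\in\mathcal{H}(G,H):\xi|_L\in\mathcal{M}(L,H)\ \forall L\in\mathcal{L}\}$. $\mathfrak{R}$ is the class of $R\in\mathfrak{T}_a\cap\mathfrak{D}_r$ with $\mathcal{M}^{\mathcal{L}(R)}(R,R)\cap\mathcal{S}(R,R)\ne\emptyset$. -}

module Defs where

open import Data.Nat using (ℕ; zero; suc; _+_; _∸_; _≤_)
open import Data.Bool using (Bool; true; false; _∧_)
open import Data.Fin using (Fin)
open import Data.List using (List; []; _∷_; length; filterᵇ; allFin)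
open import Data.List.Relation.Unary.Unique.Propositional using (Unique)
open import Data.List.Relation.Unary.Linked using (Linked)
open import Data.Product using (Σ; _×_; ∃)
open import Relation.Binary.PropositionalEquality using (_≡_; _≢_)
open import Relation.Nullary using (¬_)

record Digraph : Set where
  field
    k   : ℕ
    arc : Fin (suc k) → Fin (suc k) → Bool

open Digraph public

V : Digraph → Set
V G = Fin (suc (k G))

Arc : (G : Digraph) → V G → V G → Set
Arc G v w = arc G v w ≡ true

-- G ∈ 𝔇_r
Reflexive : Digraph → Set
Reflexive G = ∀ v → Arc G v v

IsPath : (G : Digraph) → List (V G) → Set
IsPath G ps = (ps ≢ []) × Unique ps × Linked (Arc G) ps

pathLength : {A : Set} → List A → ℕ
pathLength ps = length ps ∸ 1

lastOr : {A : Set} → A → List A → A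
lastOr x []       = x
lastOr x (y ∷ ys) = lastOr y ys

HasCycle* : Digraph → Set
HasCycle* G = Σ (V G) λ x → Σ (List (V G)) λ ys →
  IsPath G (x ∷ ys) × (ys ≢ []) × Arc G (lastOr x ys) x

-- G ∈ 𝔗_a
AcyclicStar : Digraph → Set
AcyclicStar G = ¬ HasCycle* G

-- h is the height h_G: the largest length of a path in G.
IsHeight : Digraph → ℕ → Set
IsHeight G h = (Σ (List (V G)) λ ps → IsPath G ps × pathLength ps ≡ h)
             × (∀ ps → IsPath G ps → pathLength ps ≤ h)

ι : (H : Digraph) → V H → V H → ℕ
ι H v w = length (filterᵇ (λ u → arc H v u ∧ arc H u w) (allFin (suc (k H))))

consecSum : {A : Set} → (A → A → ℕ) → List A → ℕ
consecSum f []           = 0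
consecSum f (x ∷ [])     = 0
consecSum f (x ∷ y ∷ xs) = f x y + consecSum f (y ∷ xs)

Hom : (G H : Digraph) → (V G → V H) → Set
Hom G H ξ = ∀ v w → Arc G v w → Arc H (ξ v) (ξ w)

HomStar : (G H : Digraph) → (V G → V H) → Set
HomStar G H ξ = ∀ v w → v ≢ w → Arc G v w → (Arc H (ξ v) (ξ w) × ξ v ≢ ξ w)

Strict : (G H : Digraph) → (V G → V H) → Set
Strict G H ξ = Hom G H ξ × HomStar G H ξ

-- For a path P in G (vertex list ps), a map η (restricted to V(P_×)) is a
-- homomorphism P_× → H iff it maps consecutive arcs to arcs.
HomPath : (G H : Digraph) → List (V G) → (V G → V H) → Set
HomPath G H ps η = Linked (λ a b → Arc H (η a) (η b)) ps

-- μ_η(P_×) (P_× has no loops, its arcs are the P_{i-1}P_i)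
μ : (G H : Digraph) → List (V G) → (V G → V H) → ℕ
μ G H ps η = consecSum (λ a b → ι H (η a) (η b)) ps

-- ξ|_{P_×} ∈ 𝓜(P_×,H)  (ξ|_{P_×} is a homomorphism whenever ξ ∈ 𝓗(G,H));
-- homomorphisms on V(P_×) are represented by arbitrary total maps V G → V H,
-- which is harmless since V H is nonempty (any map on V(P_×) extends).
MaximalOnPath : (G H : Digraph) → List (V G) → (V G → V H) → Set
MaximalOnPath G H ps ξ =
  HomPath G H ps ξ × (∀ η → HomPath G H ps η → μ G H ps η ≤ μ G H ps ξ)

InML : (G H : Digraph) → ℕ → (V G → V H) → Set
InML G H h ξ = Hom G H ξ ×
  (∀ ps → IsPath G ps → pathLength ps ≡ h → MaximalOnPath G H ps ξ)

-- R ∈ 𝔑 (given that h is the height of R)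
InFrakR : (R : Digraph) → ℕ → Set
InFrakR R h = Reflexive R × AcyclicStar R ×
  (Σ (V R → V R) λ ξ → InML R R h ξ × Strict R R ξ)

Antisymmetric : Digraph → Set
Antisymmetric G = ∀ v w → Arc G v w → Arc G w v → v ≡ w

Transitive : Digraph → Set
Transitive G = ∀ u v w → Arc G u v → Arc G v w → Arc G u w

-- In R (reflexive, R* acyclic) a loop has ι(x,x) = 1 and a proper arc has ι(x,y) ≥ 2,
-- with equality along a longest path, since a further vertex between x and y would
-- lengthen it.  Hence μ(P) = 2h for the identity on every P ∈ 𝓛(R), and μ_ξ(P) ≤ 2h for
-- a strict ξ, which maps P to another path.  Stretching a path Q of length m ≤ h along
-- P (p_i ↦ q_min(i,m)) gives a homomorphism with μ = Σι(Q) + (h − m), so a maximising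
-- strict ξ forces the bound.  Conversely, the image of P under any homomorphism is a
-- walk, and deleting its loops leaves a path; the bound then gives μ_η(P) ≤ 2h, so the
-- identity lies in 𝓜^𝓛(R,R) ∩ 𝓢(R,R).  In a flat poset every path has length 0 or h.

module Submission where

open import Defs
open import Data.Nat using (ℕ; zero; suc; _+_; _*_; _∸_; _≤_; z≤n; s≤s)
open import Data.Nat.Properties hiding (_≟_)
open import Data.Bool using (Bool; _∧_; T?)
open import Data.Bool.Properties using (T-∧; T-≡)
open import Data.Fin using (_≟_)
open import Data.List using (List; []; _∷_; length; map; replicate; allFin; filterᵇ; _++_)
open import Data.List.Properties using (length-map; length-++; length-++-sucʳ; length-replicate; map-cong-local)
open import Data.List.Relation.Unary.All using (All; []; _∷_)
import Data.List.Relation.Unary.All as All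
import Data.List.Relation.Unary.All.Properties as AllP
open import Data.List.Relation.Unary.AllPairs using ([]; _∷_)
open import Data.List.Relation.Unary.Any using (here; there)
open import Data.List.Relation.Unary.Linked using (Linked; []; [-]; _∷_)
import Data.List.Relation.Unary.Linked as Linked
import Data.List.Relation.Unary.Linked.Properties as Linked
open import Data.List.Relation.Unary.Unique.Propositional using (Unique)
import Data.List.Relation.Unary.Unique.Propositional.Properties as Unique
open import Data.List.Membership.Propositional using (_∈_)
open import Data.List.Membership.Propositional.Properties using (∈-∃++; ∈-allFin; ∈-filter⁺; ∈-filter⁻)
open import Data.List.Relation.Binary.Subset.Propositional using (_⊆_)
open import Data.List.Relation.Binary.Permutation.Propositional.Properties using (shift; ∈-resp-↭)
open import Data.Product using (Σ; _×_; _,_; proj₁; proj₂; uncurry; swap)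
open import Data.Empty using (⊥; ⊥-elim)
open import Function using (_∘_)
open import Function.Bundles using (_⇔_; mk⇔; Equivalence)
open import Relation.Nullary using (yes; no; contradiction)
open import Relation.Binary.Definitions using (DecidableEquality)
open import Relation.Binary.PropositionalEquality

module _ {A : Set} where

  length-≤-⊆ : {xs ys : List A} → Unique xs → xs ⊆ ys → length xs ≤ length ys
  length-≤-⊆ [] _ = z≤n
  length-≤-⊆ {x ∷ xs} (x∉xs ∷ !xs) xs⊆ys with ∈-∃++ (xs⊆ys (here refl))
  ... | as , bs , refl = ≤-trans (s≤s (length-≤-⊆ !xs xs⊆as++bs))
                                 (≤-reflexive (sym (length-++-sucʳ as x bs)))
    where
    xs⊆as++bs : xs ⊆ as ++ bs
    xs⊆as++bs z∈xs with ∈-resp-↭ (shift x as bs) (xs⊆ys (there z∈xs))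
    ... | here z≡x = contradiction (sym z≡x) (All.lookup x∉xs z∈xs)
    ... | there z∈ = z∈

  lastOr-∈ : (x y : A) (ys : List A) → lastOr x (y ∷ ys) ∈ y ∷ ys
  lastOr-∈ x y []       = here refl
  lastOr-∈ x y (z ∷ zs) = there (lastOr-∈ y z zs)

  Unique-++-∷⁻ : (x : A) (ys zs : List A) → Unique (ys ++ x ∷ zs) → Unique (x ∷ ys)
  Unique-++-∷⁻ x []       zs _ = [] ∷ []
  Unique-++-∷⁻ x (y ∷ ys) zs (y∉ ∷ !ys) with Unique-++-∷⁻ x ys zs !ys
  ... | x∉ys ∷ !ys′ = ((λ x≡y → All.head (AllP.++⁻ʳ ys y∉) (sym x≡y)) ∷ x∉ys)
                    ∷ (AllP.++⁻ˡ ys y∉ ∷ !ys′)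

  Linked-++-∷⁻ : {_∼_ : A → A → Set} (w x : A) (ys zs : List A) →
                 Linked _∼_ (w ∷ ys ++ x ∷ zs) → Linked _∼_ (w ∷ ys) × lastOr w ys ∼ x
  Linked-++-∷⁻ w x []       zs (w∼x ∷ _) = [-] , w∼x
  Linked-++-∷⁻ w x (y ∷ ys) zs (w∼y ∷ l) with Linked-++-∷⁻ y x ys zs l
  ... | l′ , last∼x = (w∼y ∷ l′) , last∼x

  consecSum-map : (f : A → A → ℕ) (g : A → A) (xs : List A) →
                  consecSum (λ a b → f (g a) (g b)) xs ≡ consecSum f (map g xs)
  consecSum-map f g []           = refl
  consecSum-map f g (x ∷ [])     = refl
  consecSum-map f g (x ∷ y ∷ xs) = cong (f (g x) (g y) +_) (consecSum-map f g (y ∷ xs))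

  consecSum-≤ : {f : A → A → ℕ} {c : ℕ} (xs : List A) →
                Linked (λ a b → f a b ≤ c) xs → consecSum f xs ≤ pathLength xs * c
  consecSum-≤ []           _          = z≤n
  consecSum-≤ (x ∷ [])     _          = z≤n
  consecSum-≤ (x ∷ y ∷ xs) (fxy≤c ∷ l) = +-mono-≤ fxy≤c (consecSum-≤ (y ∷ xs) l)

  consecSum-≥ : {f : A → A → ℕ} {c : ℕ} (xs : List A) →
                Linked (λ a b → c ≤ f a b) xs → pathLength xs * c ≤ consecSum f xs
  consecSum-≥ []           _          = z≤n
  consecSum-≥ (x ∷ [])     _          = z≤n
  consecSum-≥ (x ∷ y ∷ xs) (c≤fxy ∷ l) = +-mono-≤ c≤fxy (consecSum-≥ (y ∷ xs) l)

  stretch : ℕ → A → List A → List A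
  stretch k q qs = qs ++ replicate k (lastOr q qs)

  Linked-stretch : {_∼_ : A → A → Set} → (∀ x → x ∼ x) → (k : ℕ) (q : A) (qs : List A) →
                   Linked _∼_ (q ∷ qs) → Linked _∼_ (q ∷ stretch k q qs)
  Linked-stretch refl∼ zero    q []        _          = [-]
  Linked-stretch refl∼ (suc k) q []        _          = refl∼ q ∷ Linked-stretch refl∼ k q [] [-]
  Linked-stretch refl∼ k       q (q′ ∷ qs) (q∼q′ ∷ l) = q∼q′ ∷ Linked-stretch refl∼ k q′ qs l

  consecSum-stretch : {f : A → A → ℕ} → (∀ x → f x x ≡ 1) → (k : ℕ) (q : A) (qs : List A) →
                      consecSum f (q ∷ stretch k q qs) ≡ consecSum f (q ∷ qs) + k
  consecSum-stretch f-loop zero    q []        = refl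
  consecSum-stretch f-loop (suc k) q []        =
    cong₂ _+_ (f-loop q) (consecSum-stretch f-loop k q [])
  consecSum-stretch {f} f-loop k   q (q′ ∷ qs) =
    trans (cong (f q q′ +_) (consecSum-stretch f-loop k q′ qs)) (sym (+-assoc (f q q′) _ k))

module _ {A : Set} (_≟ᴬ_ : DecidableEquality A) where

  relabel : List A → List A → A → A → A
  relabel (p ∷ ps) (q ∷ qs) d v with v ≟ᴬ p
  ... | yes _ = q
  ... | no _  = relabel ps qs d v
  relabel _ _ d v = d

  map-relabel : (ps qs : List A) (d : A) → Unique ps → length ps ≡ length qs →
                map (relabel ps qs d) ps ≡ qs
  map-relabel []       []       d _            _  = refl
  map-relabel (p ∷ ps) (q ∷ qs) d (p∉ps ∷ !ps) eq =
    cong₂ _∷_ relabel-p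
      (trans (map-cong-local (All.map relabel-other p∉ps)) (map-relabel ps qs d !ps (suc-injective eq)))
    where
    relabel-p : relabel (p ∷ ps) (q ∷ qs) d p ≡ q
    relabel-p with p ≟ᴬ p
    ... | yes _   = refl
    ... | no p≢p = contradiction refl p≢p
    relabel-other : ∀ {v} → p ≢ v → relabel (p ∷ ps) (q ∷ qs) d v ≡ relabel ps qs d v
    relabel-other {v} p≢v with v ≟ᴬ p
    ... | yes v≡p = contradiction (sym v≡p) p≢v
    ... | no _    = refl

  compress : A → List A → List A
  compress x [] = []
  compress x (y ∷ ys) with x ≟ᴬ y
  ... | yes _ = compress y ys
  ... | no _  = y ∷ compress y ys

  Linked-compress : {_∼_ : A → A → Set} (x : A) (ys : List A) → Linked _∼_ (x ∷ ys) →
                    Linked (λ a b → a ≢ b × a ∼ b) (x ∷ compress x ys)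
  Linked-compress x []       _         = [-]
  Linked-compress x (y ∷ ys) (x∼y ∷ l) with x ≟ᴬ y
  ... | yes refl = Linked-compress y ys l
  ... | no x≢y   = (x≢y , x∼y) ∷ Linked-compress y ys l

  consecSum-compress : {f : A → A → ℕ} → (∀ x → f x x ≡ 1) → (x : A) (ys : List A) →
                       consecSum f (x ∷ ys) + length (compress x ys)
                         ≡ consecSum f (x ∷ compress x ys) + length ys
  consecSum-compress f-loop x [] = refl
  consecSum-compress {f} f-loop x (y ∷ ys) with x ≟ᴬ y
  ... | yes refl = begin
    (f x x + s) + c   ≡⟨ cong (λ t → (t + s) + c) (f-loop x) ⟩
    suc (s + c)       ≡⟨ cong suc (consecSum-compress f-loop x ys) ⟩
    suc (s′ + l)      ≡⟨ sym (+-suc s′ l) ⟩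
    s′ + suc l        ∎
    where
    open ≡-Reasoning
    s c s′ l : ℕ
    s = consecSum f (x ∷ ys); c = length (compress x ys)
    s′ = consecSum f (x ∷ compress x ys); l = length ys
  ... | no _ = begin
    (i + s) + suc c   ≡⟨ +-assoc i s (suc c) ⟩
    i + (s + suc c)   ≡⟨ cong (i +_) (+-suc s c) ⟩
    i + suc (s + c)   ≡⟨ cong (λ t → i + suc t) (consecSum-compress f-loop y ys) ⟩
    i + suc (s′ + l)  ≡⟨ cong (i +_) (sym (+-suc s′ l)) ⟩
    i + (s′ + suc l)  ≡⟨ sym (+-assoc i s′ (suc l)) ⟩
    (i + s′) + suc l  ∎
    where
    open ≡-Reasoning
    i s c s′ l : ℕ
    i = f x y
    s = consecSum f (y ∷ ys); c = length (compress y ys)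
    s′ = consecSum f (y ∷ compress y ys); l = length ys

n+n≡n*2 : ∀ n → n + n ≡ n * 2
n+n≡n*2 n = trans (cong (n +_) (sym (+-identityʳ n))) (*-comm 2 n)

+-∸-cancel-≤ : ∀ {a m h} → m ≤ h → a + (h ∸ m) ≤ h * 2 → a ≤ h + m
+-∸-cancel-≤ {a} {m} {h} m≤h a+h∸m≤2h = +-cancelʳ-≤ (h ∸ m) a (h + m) (begin
  a + (h ∸ m)       ≤⟨ a+h∸m≤2h ⟩
  h * 2             ≡⟨ sym (n+n≡n*2 h) ⟩
  h + h             ≡⟨ cong (h +_) (sym (m+[n∸m]≡n m≤h)) ⟩
  h + (m + (h ∸ m)) ≡⟨ sym (+-assoc h m (h ∸ m)) ⟩
  h + m + (h ∸ m)   ∎)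
  where open ≤-Reasoning

module _ (R : Digraph) where

  Arc* : V R → V R → Set
  Arc* v w = v ≢ w × Arc R v w

  Walk* : List (V R) → Set
  Walk* = Linked Arc*

  ConsecSumBound : ℕ → Set
  ConsecSumBound h = (ps : List (V R)) → IsPath R ps → consecSum (ι R) ps ≤ h + pathLength ps

  LongestFrom : V R → ℕ → Set
  LongestFrom x n = ∀ ys → Walk* (x ∷ ys) → length ys ≤ n

  LongestFrom-tail : ∀ {x y n} → Arc* x y → LongestFrom x (suc n) → LongestFrom y n
  LongestFrom-tail xy longest ys w = ≤-pred (longest (_ ∷ ys) (xy ∷ w))

  IsPath⇒Walk* : ∀ {ps} → IsPath R ps → Walk* ps
  IsPath⇒Walk* (_ , !ps , l) = go !ps l
    where
    go : ∀ {ps} → Unique ps → Linked (Arc R) ps → Walk* ps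
    go _                  []        = []
    go _                  [-]       = [-]
    go ((x≢y ∷ _) ∷ !ps) (xy ∷ l)  = (x≢y , xy) ∷ go !ps l

  inInterval : V R → V R → V R → Bool
  inInterval x y u = arc R x u ∧ arc R u y

  interval : V R → V R → List (V R)
  interval x y = filterᵇ (inInterval x y) (allFin _)

  ∈-interval⁻ : ∀ {x y u} → u ∈ interval x y → Arc R x u × Arc R u y
  ∈-interval⁻ {x} {y} u∈ with Equivalence.to T-∧ (proj₂ (∈-filter⁻ (T? ∘ inInterval x y) u∈))
  ... | Txu , Tuy = Equivalence.to T-≡ Txu , Equivalence.to T-≡ Tuy

  ∈-interval⁺ : ∀ {x y u} → Arc R x u → Arc R u y → u ∈ interval x y
  ∈-interval⁺ {x} {y} {u} xu uy = ∈-filter⁺ (T? ∘ inInterval x y) (∈-allFin u)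
    (Equivalence.from T-∧ (Equivalence.from T-≡ xu , Equivalence.from T-≡ uy))

  ι-≤ : ∀ {x y} bs → (∀ {u} → Arc R x u → Arc R u y → u ∈ bs) → ι R x y ≤ length bs
  ι-≤ {x} {y} bs ⊆bs = length-≤-⊆ (Unique.filter⁺ (T? ∘ inInterval x y) (Unique.allFin⁺ _))
                                  (λ u∈ → uncurry ⊆bs (∈-interval⁻ u∈))

  ι-≥ : ∀ {x y} bs → Unique bs → All (λ u → Arc R x u × Arc R u y) bs → length bs ≤ ι R x y
  ι-≥ bs !bs arcs = length-≤-⊆ !bs (λ u∈bs → uncurry ∈-interval⁺ (All.lookup arcs u∈bs))

  ι-arc*-≥ : Reflexive R → ∀ {x y} → Arc* x y → 2 ≤ ι R x y
  ι-arc*-≥ rfl {x} {y} (x≢y , xy) =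
    ι-≥ (x ∷ y ∷ []) ((x≢y ∷ []) ∷ [] ∷ []) ((rfl x , xy) ∷ (xy , rfl y) ∷ [])

  ι-≤-2 : ∀ {x y r} → Walk* (x ∷ y ∷ r) → LongestFrom x (suc (length r)) → ι R x y ≤ 2
  ι-≤-2 {x} {y} {r} ((_ , xy) ∷ w) longest = ι-≤ (x ∷ y ∷ []) ends
    where
    ends : ∀ {u} → Arc R x u → Arc R u y → u ∈ x ∷ y ∷ []
    ends {u} xu uy with u ≟ x | u ≟ y
    ... | yes u≡x | _       = here u≡x
    ... | no _    | yes u≡y = there (here u≡y)
    ... | no u≢x  | no u≢y  =
      contradiction (longest (u ∷ y ∷ r) ((u≢x ∘ sym , xu) ∷ (u≢y , uy) ∷ w)) 1+n≰n

  ι-≤-2-along : ∀ {x r} → Walk* (x ∷ r) → LongestFrom x (length r) →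
                Linked (λ a b → ι R a b ≤ 2) (x ∷ r)
  ι-≤-2-along {r = []}    _               _       = [-]
  ι-≤-2-along {r = y ∷ r} w@(xy ∷ w′) longest =
    ι-≤-2 w longest ∷ ι-≤-2-along w′ (LongestFrom-tail xy longest)

  longest-consecSum-≤ : ∀ {x r n} → Walk* (x ∷ r) → LongestFrom x n → length r ≡ n →
                        consecSum (ι R) (x ∷ r) ≤ n * 2
  longest-consecSum-≤ w longest refl = consecSum-≤ _ (ι-≤-2-along w longest)

  Walk*-consecSum-≥ : Reflexive R → ∀ {x r} → Walk* (x ∷ r) → length r * 2 ≤ consecSum (ι R) (x ∷ r)
  Walk*-consecSum-≥ rfl w = consecSum-≥ _ (Linked.map (ι-arc*-≥ rfl) w)

  map-Walk* : ∀ {ξ} → HomStar R R ξ → ∀ {ps} → Walk* ps → Walk* (map ξ ps)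
  map-Walk* strict* = Linked.map⁺ ∘ Linked.map (λ (v≢w , vw) → swap (strict* _ _ v≢w vw))

  module _ (acyclic : AcyclicStar R) where

    acyclic⇒antisymmetric : Antisymmetric R
    acyclic⇒antisymmetric v w vw wv with v ≟ w
    ... | yes v≡w = v≡w
    ... | no v≢w  =
      ⊥-elim (acyclic (v , w ∷ [] , ((λ ()) , ((v≢w ∷ []) ∷ [] ∷ []) , vw ∷ [-]) , (λ ()) , wv))

    Walk*-head-∉-tail : ∀ {x ys} → Walk* (x ∷ ys) → Unique ys → x ∈ ys → ⊥
    Walk*-head-∉-tail {x} w !ys x∈ys with ∈-∃++ x∈ys
    ... | [] , _ , refl = proj₁ (Linked.head w) refl
    ... | as@(_ ∷ _) , bs , refl with Linked-++-∷⁻ x x as bs w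
    ...   | w′ , (_ , back) =
      acyclic (x , as , ((λ ()) , Unique-++-∷⁻ x as bs !ys , Linked.map proj₂ w′) , (λ ()) , back)

    Walk*⇒Unique : ∀ {ps} → Walk* ps → Unique ps
    Walk*⇒Unique []                   = []
    Walk*⇒Unique [-]                  = [] ∷ []
    Walk*⇒Unique {_ ∷ ys} w@(_ ∷ w′) =
      AllP.¬Any⇒All¬ ys (Walk*-head-∉-tail w (Walk*⇒Unique w′)) ∷ Walk*⇒Unique w′

    Walk*⇒IsPath : ∀ {x ys} → Walk* (x ∷ ys) → IsPath R (x ∷ ys)
    Walk*⇒IsPath w = (λ ()) , Walk*⇒Unique w , Linked.map proj₂ w

    height⇒LongestFrom : ∀ {h} → (∀ ps → IsPath R ps → pathLength ps ≤ h) → ∀ x → LongestFrom x h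
    height⇒LongestFrom bound x ys w = bound (x ∷ ys) (Walk*⇒IsPath w)

    strict-μ-≤ : ∀ {h ξ} → (∀ ps → IsPath R ps → pathLength ps ≤ h) → HomStar R R ξ →
                 ∀ {p ps} → IsPath R (p ∷ ps) → length ps ≡ h → μ R R (p ∷ ps) ξ ≤ h * 2
    strict-μ-≤ {h} {ξ} bound strict* {p} {ps} path len = begin
      μ R R (p ∷ ps) ξ             ≡⟨ consecSum-map (ι R) ξ (p ∷ ps) ⟩
      consecSum (ι R) (map ξ (p ∷ ps)) ≤⟨ longest-consecSum-≤ (map-Walk* strict* (IsPath⇒Walk* path))
                                            (height⇒LongestFrom bound (ξ p)) (trans (length-map ξ ps) len) ⟩
      h * 2                        ∎
      where open ≤-Reasoning

    module _ (rfl : Reflexive R) where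

      ι-loop : ∀ x → ι R x x ≡ 1
      ι-loop x = ≤-antisym
        (ι-≤ (x ∷ []) (λ xu ux → here (acyclic⇒antisymmetric _ _ ux xu)))
        (ι-≥ (x ∷ []) ([] ∷ []) ((rfl x , rfl x) ∷ []))

      stretched-hom : ∀ {p ps q qs} → Unique (p ∷ ps) → Linked (Arc R) (q ∷ qs) →
        length qs ≤ length ps →
        Σ (V R → V R) λ η → HomPath R R (p ∷ ps) η ×
          μ R R (p ∷ ps) η ≡ consecSum (ι R) (q ∷ qs) + (length ps ∸ length qs)
      stretched-hom {p} {ps} {q} {qs} !ps walk m≤n = η , Linked.map⁻ η-walk , μη
        where
        gap : ℕ
        gap = length ps ∸ length qs
        η : V R → V R
        η = relabel _≟_ (p ∷ ps) (q ∷ stretch gap q qs) q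
        map-η : map η (p ∷ ps) ≡ q ∷ stretch gap q qs
        map-η = map-relabel _≟_ (p ∷ ps) _ q !ps (cong suc (sym (begin
          length (qs ++ replicate gap _) ≡⟨ length-++ qs ⟩
          length qs + length (replicate gap _) ≡⟨ cong (length qs +_) (length-replicate gap) ⟩
          length qs + gap ≡⟨ m+[n∸m]≡n m≤n ⟩
          length ps ∎)))
          where open ≡-Reasoning
        η-walk : Linked (Arc R) (map η (p ∷ ps))
        η-walk = subst (Linked (Arc R)) (sym map-η) (Linked-stretch rfl gap q qs walk)
        μη : μ R R (p ∷ ps) η ≡ consecSum (ι R) (q ∷ qs) + gap
        μη = trans (consecSum-map (ι R) η (p ∷ ps))
               (trans (cong (consecSum (ι R)) map-η) (consecSum-stretch ι-loop gap q qs))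

      -- Removing the l − c loops of a walk lowers its sum by l − c and leaves a path.
      walk-consecSum-≤ : ∀ {h} → ConsecSumBound h → ∀ x ys → Linked (Arc R) (x ∷ ys) →
                         consecSum (ι R) (x ∷ ys) ≤ h + length ys
      walk-consecSum-≤ {h} bound x ys walk = +-cancelʳ-≤ c (consecSum (ι R) (x ∷ ys)) (h + l) (begin
        consecSum (ι R) (x ∷ ys) + c            ≡⟨ consecSum-compress _≟_ ι-loop x ys ⟩
        consecSum (ι R) (x ∷ compress _≟_ x ys) + l
          ≤⟨ +-monoˡ-≤ l (bound _ (Walk*⇒IsPath (Linked-compress _≟_ x ys walk))) ⟩
        h + c + l                                ≡⟨ +-assoc h c l ⟩
        h + (c + l)                              ≡⟨ cong (h +_) (+-comm c l) ⟩
        h + (l + c)                              ≡⟨ sym (+-assoc h l c) ⟩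
        h + l + c                                ∎)
        where
        open ≤-Reasoning
        c l : ℕ
        c = length (compress _≟_ x ys)
        l = length ys

module _ (R : Digraph) (acyclic : AcyclicStar R) (rfl : Reflexive R) (h : ℕ) where

  ConsecSumBound⇒InFrakR : ConsecSumBound R h → InFrakR R h
  ConsecSumBound⇒InFrakR bound =
    rfl , acyclic , (λ v → v) , ((λ _ _ vw → vw) , id-maximal)
        , ((λ _ _ vw → vw) , λ _ _ v≢w vw → vw , v≢w)
    where
    id-maximal : ∀ ps → IsPath R ps → pathLength ps ≡ h → MaximalOnPath R R ps (λ v → v)
    id-maximal [] (nonempty , _) _ = contradiction refl nonempty
    id-maximal (p ∷ ps) path@(_ , _ , walk) len = walk , λ η hom → begin
      μ R R (p ∷ ps) η                  ≡⟨ consecSum-map (ι R) η (p ∷ ps) ⟩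
      consecSum (ι R) (map η (p ∷ ps))  ≤⟨ walk-consecSum-≤ R acyclic rfl bound (η p) (map η ps)
                                              (Linked.map⁺ hom) ⟩
      h + length (map η ps)             ≡⟨ cong (h +_) (trans (length-map η ps) len) ⟩
      h + h                             ≡⟨ n+n≡n*2 h ⟩
      h * 2                             ≡⟨ cong (_* 2) (sym len) ⟩
      length ps * 2                     ≤⟨ Walk*-consecSum-≥ R rfl (IsPath⇒Walk* R path) ⟩
      consecSum (ι R) (p ∷ ps)          ∎
      where open ≤-Reasoning

  module _ (height : IsHeight R h) where

    maximal-strict⇒consecSum-≤ : ∀ {ξ} → InML R R h ξ → HomStar R R ξ →
      ∀ {p ps} → IsPath R (p ∷ ps) → length ps ≡ h →
      ∀ {q qs} → IsPath R (q ∷ qs) → consecSum (ι R) (q ∷ qs) ≤ h + length qs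
    maximal-strict⇒consecSum-≤ {ξ} (_ , maximal) strict* {p} {ps} pathP@(_ , !ps , _) len
                               {q} {qs} pathQ@(_ , _ , walkQ)
      with m≤h ← proj₂ height (q ∷ qs) pathQ
      with η , hom , μη ← stretched-hom R acyclic rfl !ps walkQ (subst (length qs ≤_) (sym len) m≤h)
      = +-∸-cancel-≤ m≤h (begin
      consecSum (ι R) (q ∷ qs) + (h ∸ length qs)  ≡⟨ cong (λ n → _ + (n ∸ length qs)) (sym len) ⟩
      consecSum (ι R) (q ∷ qs) + (length ps ∸ length qs) ≡⟨ sym μη ⟩
      μ R R (p ∷ ps) η                            ≤⟨ proj₂ (maximal (p ∷ ps) pathP len) η hom ⟩
      μ R R (p ∷ ps) ξ                            ≤⟨ strict-μ-≤ R acyclic (proj₂ height) strict* pathP len ⟩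
      h * 2                                       ∎)
      where open ≤-Reasoning

    InFrakR⇒ConsecSumBound : InFrakR R h → ConsecSumBound R h
    InFrakR⇒ConsecSumBound _ [] (nonempty , _) = contradiction refl nonempty
    InFrakR⇒ConsecSumBound (_ , _ , _ , inML , (_ , strict*)) (q ∷ qs) pathQ with proj₁ height
    ... | [] , (nonempty , _) , _ = contradiction refl nonempty
    ... | p ∷ ps , pathP , len    = maximal-strict⇒consecSum-≤ inML strict* pathP len pathQ

poset⇒AcyclicStar : (R : Digraph) → Antisymmetric R → Transitive R → AcyclicStar R
poset⇒AcyclicStar R anti tr (x , [] , _ , ys≢[] , _) = ys≢[] refl
poset⇒AcyclicStar R anti tr (x , y ∷ ys , (_ , (x∉ys ∷ _) , xy ∷ walk) , _ , back) =
  All.lookup x∉ys last∈ys (anti x _ (All.lookup (Linked.Linked⇒All (tr _ _ _) xy walk) last∈ys) back)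
  where
  last∈ys : lastOr y ys ∈ y ∷ ys
  last∈ys = lastOr-∈ x y ys

flatPoset-ConsecSumBound : (R : Digraph) → AcyclicStar R → (h : ℕ) → IsHeight R h → h ≤ 1 →
                           ConsecSumBound R h
flatPoset-ConsecSumBound R acyclic h height h≤1 [] (nonempty , _) = contradiction refl nonempty
flatPoset-ConsecSumBound R acyclic h height h≤1 (q ∷ []) _ = z≤n
flatPoset-ConsecSumBound R acyclic h height h≤1 (q ∷ q′ ∷ qs) path = begin
  consecSum (ι R) (q ∷ q′ ∷ qs) ≤⟨ longest-consecSum-≤ R (IsPath⇒Walk* R path)
                                     (height⇒LongestFrom R acyclic (proj₂ height) q) len ⟩
  h * 2                         ≡⟨ sym (n+n≡n*2 h) ⟩
  h + h                         ≡⟨ cong (h +_) (sym len) ⟩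
  h + suc (length qs)           ∎
  where
  open ≤-Reasoning
  len : suc (length qs) ≡ h
  len = ≤-antisym (proj₂ height _ path) (≤-trans h≤1 (s≤s z≤n))

proposition1 :
    ((R : Digraph) → AcyclicStar R → Reflexive R → (h : ℕ) → IsHeight R h →
      (InFrakR R h ⇔ ((ps : List (V R)) → IsPath R ps →
        consecSum (ι R) ps ≤ h + pathLength ps)))
    ×
    ((R : Digraph) → Reflexive R → Antisymmetric R → Transitive R →
      (h : ℕ) → IsHeight R h → h ≤ 1 → InFrakR R h)
proposition1 =
  (λ R acyclic rfl h height →
    mk⇔ (InFrakR⇒ConsecSumBound R acyclic rfl h height) (ConsecSumBound⇒InFrakR R acyclic rfl h))
  ,
  (λ R rfl anti tr h height h≤1 →
    let acyclic = poset⇒AcyclicStar R anti tr in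
    ConsecSumBound⇒InFrakR R acyclic rfl h (flatPoset-ConsecSumBound R acyclic h height h≤1))
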